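{- Let $n,a\ge 1$, $d=n+a$, let $S^R\subseteq\{0,1\}^n$ and $A\subseteq\{0,1\}^a$ be finite sets, and let $\sigma\colon S^R\to A$ be a function (in the paper, $S^R$ is the set of states of a player in an I/O game with binary variables that are reachable from a fixed initial state under a memoryless strategy $\tilde\sigma$, $A$ is that player's action set, and $\sigma=\tilde\sigma|_{S^R}$). Identify a pair $\langle s,a'\rangle\in S^R\times A$ with the concatenated vector in $\{0,1\}^d$, and define $\mathit{Good}=\{\langle s,\sigma(s)\rangle : s\in S^R\}$, $\mathit{Bad}=\{\langle s,a'\rangle\in S^R\times A : a'\neq\sigma(s)\}$, $\mathit{Train}=\mathit{Good}\uplus\mathit{Bad}\subseteq\{0,1\}^d$. Then, for every fixed $k\ge 1$ and every resolution of the ties in the $\arg\max$ choices, the $k$-look-ahead ID3 algorithm (described in the context) run on input $\mathit{Train}$ (partitioned into $\mathit{Good}$ and $\mathit{Bad}$) terminates and outputs a decision tree $\mathcal{T}$ with $\mathcal{L}(\mathcal{T})\cap\mathit{Train}=\mathit{Good}$; that is, for all $s\in S^R$ and $a'\in A$ we have $\langle s,a'\rangle\in\mathcal{L}(\mathcal{T})$ if and only if $\sigma(s)=a'$, so $\mathcal{T}$ represents $\sigma$.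
   Context: A decision tree over $\{0,1\}^d$ is a tuple $\mathcal{T}=(T,\rho,\theta)$ where $T$ is a finite rooted binary ordered tree with inner nodes $N$ and leaves $L$, $\rho\colon N\to\{1,\dots,d\}$, and $\theta\colon L\to\{\mathit{YES},\mathit{NO}\}$. For $\vec x\in\{0,1\}^d$, follow the path from the root where at each inner node $m$ one goes to the first child iff $\vec x(\rho(m))=0$ (and to the second child otherwise); $\vec x\in\mathcal{L}(\mathcal{T})$ iff the leaf $\ell$ reached satisfies $\theta(\ell)=\mathit{YES}$. Notation for the algorithm. Leaves are identified with subsets $\ell\subseteq\mathit{Train}$ (the samples routed to them). A leaf is mixed if it intersects both $\mathit{Good}$ and $\mathit{Bad}$. For $i\in\{1,\dots,d\}$ let $\ell[i=0]=\{\vec x\in\ell: x_i=0\}$ and $\ell[i=1]=\ell\setminus\ell[i=0]$. Splitting $\ell$ on $i$ makes $\ell$ an inner node with $\rho(\ell)=i$ and first child $\ell[i=0]$, second child $\ell[i=1]$. The entropy is $H(\ell)=-\frac{|\ell\cap\mathit{Good}|}{|\ell|}\log_2\frac{|\ell\cap\mathit{Good}|}{|\ell|}-\frac{|\ell\cap\mathit{Bad}|}{|\ell|}\log_2\frac{|\ell\cap\mathit{Bad}|}{|\ell|}$ (with $0\log 0=0$). Define $WE^0(\ell,i)=|\ell|\cdot H(\ell)$ (taken as $0$ for $\ell=\emptyset$) and for $j\ge1$, $WE^j(\ell,i)=\min_{i_0,i_1\in\{1,\dots,d\}}\big(WE^{j-1}(\ell[i=0],i_0)+WE^{j-1}(\ell[i=1],i_1)\big)$.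 The $j$-look-ahead information gain of $i$ in $\ell$ is $H(\ell)-WE^j(\ell,i)/|\ell|$. Let $\mathit{maxclass}(\ell)=\mathit{YES}$ if $|\ell\cap\mathit{Good}|\ge|\ell\cap\mathit{Bad}|$ and $\mathit{NO}$ otherwise. The $k$-look-ahead ID3 algorithm: start with the tree consisting of a single leaf $\mathit{Train}$ with $\theta(\mathit{Train})=\mathit{YES}$. While some mixed leaf $\ell$ exists: let $j\in\{1,\dots,k\}$ be the smallest index such that some $i$ has positive $j$-look-ahead information gain in $\ell$; if such $j$ exists, let $\mathit{bit}$ be an $i$ maximizing the $j$-look-ahead information gain in $\ell$; otherwise let $\mathit{bit}$ be an $i\in\{1,\dots,d\}$ maximizing $\max\Big\{\frac{|\ell[i=0]\cap\mathit{Bad}|}{|\ell[i=0]|}+\frac{|\ell[i=1]\cap\mathit{Good}|}{|\ell[i=1]|},\ \frac{|\ell[i=0]\cap\mathit{Good}|}{|\ell[i=0]|}+\frac{|\ell[i=1]\cap\mathit{Bad}|}{|\ell[i=1]|}\Big\}$, with the convention that any term $0/0$ equals $0$. Then split $\ell$ on $\mathit{bit}$ into $\ell_0=\ell[\mathit{bit}=0]$ and $\ell_1=\ell[\mathit{bit}=1]$, and set $\theta(\ell_0)=\mathit{maxclass}(\ell_0)$, $\theta(\ell_1)=\mathit{maxclass}(\ell_1)$. When no mixed leaf remains, return the tree. -}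

module Defs where

open import Data.Bool using (Bool; true; false; not; if_then_else_)
open import Data.Nat as ℕ using (ℕ; zero; suc; _^_; _≤ᵇ_; NonZero)
open import Data.Nat.Properties using (m^n≢0; m*n≢0)
open import Data.Integer using (+_)
open import Data.Fin using (Fin)
import Data.Fin as Fin
open import Data.Vec using (Vec; lookup)
open import Data.List using (List; length; filterᵇ)
open import Data.List.Relation.Unary.Any using (Any)
open import Data.Product using (_×_; _,_; proj₁; proj₂; ∃-syntax)
open import Data.Sum using (_⊎_)
open import Relation.Binary.PropositionalEquality using (_≡_)
open import Relation.Nullary using (¬_)
open import Data.Rational.Unnormalised using (ℚᵘ; 0ℚᵘ; _/_; _*_; _+_; _⊓_; _⊔_; _<_; _≤_)

-- Decision trees over {0,1}^d  (YES = true, NO = false;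
-- bit value 0 = false, 1 = true).  Inner node  node i t₀ t₁  has
-- ρ = i, first child t₀ (taken when x(i) = 0), second child t₁.

data Tree (d : ℕ) : Set where
  leaf : Bool → Tree d
  node : Fin d → Tree d → Tree d → Tree d

eval : ∀ {d} → Tree d → Vec Bool d → Bool
eval (leaf c)       x = c
eval (node i t₀ t₁) x = if lookup x i then eval t₁ x else eval t₀ x

Lang : ∀ {d} → Tree d → Vec Bool d → Set
Lang t x = eval t x ≡ true

-- Samples: a vector together with its label (true = Good, false = Bad).

Sample : ℕ → Set
Sample d = Vec Bool d × Bool

module _ {d : ℕ} where

  split0 : Fin d → List (Sample d) → List (Sample d)
  split0 i = filterᵇ (λ x → not (lookup (proj₁ x) i))

  split1 : Fin d → List (Sample d) → List (Sample d)
  split1 i = filterᵇ (λ x → lookup (proj₁ x) i)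

  nGood : List (Sample d) → ℕ
  nGood ℓ = length (filterᵇ proj₂ ℓ)

  nBad : List (Sample d) → ℕ
  nBad ℓ = length (filterᵇ (λ x → not (proj₂ x)) ℓ)

  Mixed : List (Sample d) → Set
  Mixed ℓ = Any (λ x → proj₂ x ≡ true) ℓ × Any (λ x → proj₂ x ≡ false) ℓ

  maxclass : List (Sample d) → Bool
  maxclass ℓ = nBad ℓ ≤ᵇ nGood ℓ

-- Entropy quantities, represented exactly through 2^(·).
-- WE⁰(ℓ) = |ℓ| H(ℓ) = |ℓ| log|ℓ| − g log g − b log b, hence
--   2^(WE⁰(ℓ)) = |ℓ|^|ℓ| / (g^g · b^b)    (= 1 for ℓ = ∅),
-- and 2^(WE^j(ℓ,i)) = min_{i₀,i₁} 2^(WE^{j-1}(ℓ₀,i₀)) · 2^(WE^{j-1}(ℓ₁,i₁)).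
-- Since 2^(·) is strictly monotone, all comparisons of WE-values
-- (and hence of information gains in a fixed ℓ) are comparisons of these
-- exact rationals.

selfPow≢0 : ∀ m → NonZero (m ^ m)
selfPow≢0 zero    = _
selfPow≢0 (suc m) = m^n≢0 (suc m) (suc m)

denom≢0 : ∀ g b → NonZero (g ^ g ℕ.* b ^ b)
denom≢0 g b = m*n≢0 (g ^ g) (b ^ b) {{selfPow≢0 g}} {{selfPow≢0 b}}

minFin : ∀ {m} → (Fin (suc m) → ℚᵘ) → ℚᵘ
minFin {zero}  f = f Fin.zero
minFin {suc m} f = f Fin.zero ⊓ minFin (λ i → f (Fin.suc i))

-- fraction p/q with the convention 0/0 = 0
frac : ℕ → ℕ → ℚᵘ
frac p zero    = 0ℚᵘ
frac p (suc q) = (+ p) / suc q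

module _ {d' : ℕ} where

  private
    D : ℕ
    D = suc d'

  expWE0 : List (Sample D) → ℚᵘ
  expWE0 ℓ = _/_ (+ (length ℓ ^ length ℓ)) (nGood ℓ ^ nGood ℓ ℕ.* nBad ℓ ^ nBad ℓ)
               {{denom≢0 (nGood ℓ) (nBad ℓ)}}

  expWE : ℕ → List (Sample D) → Fin D → ℚᵘ
  expWE zero    ℓ i = expWE0 ℓ
  expWE (suc j) ℓ i =
    minFin (λ i₀ → minFin (λ i₁ → expWE j (split0 i ℓ) i₀ * expWE j (split1 i ℓ) i₁))

  -- "i has positive j-look-ahead information gain in ℓ":
  --   H(ℓ) − WE^j(ℓ,i)/|ℓ| > 0  ⇔  WE^j(ℓ,i) < WE⁰(ℓ)   (ℓ ≠ ∅)
  PosGain : ℕ → List (Sample D) → Fin D → Set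
  PosGain j ℓ i = expWE j ℓ i < expWE0 ℓ

  -- "i maximises the j-look-ahead information gain in ℓ"
  --   ⇔ i minimises WE^j(ℓ,·)
  MaxGain : ℕ → List (Sample D) → Fin D → Set
  MaxGain j ℓ i = ∀ i' → expWE j ℓ i ≤ expWE j ℓ i'

  score : List (Sample D) → Fin D → ℚᵘ
  score ℓ i =
    (frac (nBad (split0 i ℓ)) (length (split0 i ℓ)) + frac (nGood (split1 i ℓ)) (length (split1 i ℓ)))
    ⊔ (frac (nGood (split0 i ℓ)) (length (split0 i ℓ)) + frac (nBad (split1 i ℓ)) (length (split1 i ℓ)))

  -- the bits the k-look-ahead ID3 algorithm may choose in leaf ℓ
  -- (any tie resolution is allowed)
  ValidBit : ℕ → List (Sample D) → Fin D → Set
  ValidBit k ℓ bit =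
      (∃[ j ] (1 ℕ.≤ j × j ℕ.≤ k
               × (∃[ i ] PosGain j ℓ i)
               × (∀ j' → 1 ℕ.≤ j' → j' ℕ.< j → ∀ i → ¬ PosGain j' ℓ i)
               × MaxGain j ℓ bit))
    ⊎ ((∀ j → 1 ℕ.≤ j → j ℕ.≤ k → ∀ i → ¬ PosGain j ℓ i)
       × (∀ i → score ℓ i ≤ score ℓ bit))

  -- One iteration of the algorithm: a tree t whose leaves are
  -- identified with the samples routed to them (starting with ℓ at the
  -- root of t); some mixed leaf is split on a valid bit.
  data Step (k : ℕ) : List (Sample D) → Tree D → Tree D → Set where
    here  : ∀ {ℓ c bit} → Mixed ℓ → ValidBit k ℓ bit →
            Step k ℓ (leaf c)
                 (node bit (leaf (maxclass (split0 bit ℓ))) (leaf (maxclass (split1 bit ℓ))))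
    left  : ∀ {ℓ i t₀ t₀' t₁} → Step k (split0 i ℓ) t₀ t₀' →
            Step k ℓ (node i t₀ t₁) (node i t₀' t₁)
    right : ∀ {ℓ i t₀ t₁ t₁'} → Step k (split1 i ℓ) t₁ t₁' →
            Step k ℓ (node i t₀ t₁) (node i t₀ t₁')

  NoMixedLeaf : List (Sample D) → Tree D → Set
  NoMixedLeaf ℓ (leaf c)       = ¬ Mixed ℓ
  NoMixedLeaf ℓ (node i t₀ t₁) = NoMixedLeaf (split0 i ℓ) t₀ × NoMixedLeaf (split1 i ℓ) t₁

-- The training set built from σ : S^R → A.  States s ∈ {0,1}^n,
-- actions in {0,1}^a, ⟨s,a'⟩ = s ++ a' ∈ {0,1}^(n+a).

open import Data.Vec using (_++_)
open import Data.Vec.Properties using (≡-dec)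
import Data.Bool as B
open import Data.List using (map; concatMap; filter) renaming (_++_ to _++ˡ_)
open import Relation.Nullary using (¬?)

module _ {n a : ℕ} (SR : List (Vec Bool n)) (A : List (Vec Bool a))
         (σ : Vec Bool n → Vec Bool a) where

  GoodSamples : List (Sample (n ℕ.+ a))
  GoodSamples = map (λ s → (s ++ σ s , true)) SR

  BadSamples : List (Sample (n ℕ.+ a))
  BadSamples = concatMap
    (λ s → map (λ a' → (s ++ a' , false)) (filter (λ a' → ¬? (≡-dec B._≟_ a' (σ s))) A)) SR

  Train : List (Sample (n ℕ.+ a))
  Train = GoodSamples ++ˡ BadSamples

-- Every vector of Train carries a single label (⟨s,b⟩ is Good iff σ(s) = b), so two
-- samples of a mixed leaf differ in some bit, and splitting on that bit leaves both
-- children nonempty.  ID3 never splits a mixed leaf ℓ trivially.  If the chosen bit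
-- sends all of ℓ to one side, then WE^j(ℓ,bit) = min_i WE^(j-1)(ℓ,i) ≥ WE⁰(ℓ) by the
-- minimality of j, so bit has no positive gain although some bit has.  If no bit has
-- positive gain, a trivial split scores max(|ℓ∩Bad|, |ℓ∩Good|)/|ℓ| < 1, whereas a
-- nontrivial one scores at least 1 because its two candidate sums add up to 2.  Hence
-- every step lowers Σ_leaves (|ℓ| − 1), and the run terminates.  A leaf that is not
-- mixed is labelled with the class of all its samples, so a tree without mixed leaves
-- classifies Train correctly.

{-# OPTIONS --safe #-}
module Submission where

open import Defs
open import Data.Bool as Bool using (Bool; true; false; not; T?)
open import Data.Bool.Properties using (T-≡; T-not-≡)
open import Data.Nat using (ℕ; zero; suc; pred; _+_; _*_; _≤_; _<_; _≤ᵇ_; z≤n; s≤s)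
open import Data.Nat.Properties
  using ( +-suc; +-identityʳ; m<m+n; m<n+m; +-monoˡ-<; +-monoʳ-<
        ; ≤-refl; ≤-reflexive; ≤-pred; m≤n⇒m≤1+n; m≤n⇒m<n∨m≡n )
open import Data.Nat.Induction using (<-wellFounded)
open import Data.Integer as ℤ using (+_)
import Data.Integer.Properties as ℤ
open import Data.Rational.Unnormalised as ℚ using (ℚᵘ; 1ℚᵘ; *≡*; *<*)
import Data.Rational.Unnormalised.Properties as ℚₚ
open import Algebra.Bundles using (CommutativeMonoid)
open import Algebra.Properties.CommutativeSemigroup
  (CommutativeMonoid.commutativeSemigroup ℚₚ.+-0-commutativeMonoid) using (interchange)
open import Data.Fin using (Fin)
import Data.Fin as Fin
open import Data.Fin.Properties using (¬∀⟶∃¬; any?)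
open import Data.Vec using (Vec; lookup; _++_)
open import Data.Vec.Properties using (≡-dec; ++-injective)
open import Data.Vec.Relation.Binary.Pointwise.Extensional using (ext; Pointwise-≡⇒≡)
open import Data.List using (List; []; _∷_; length; filterᵇ; filter; map; allFin)
open import Data.List.Properties using (filter-complete; filter-some; filter-none)
open import Data.List.Relation.Unary.Any as Any using (Any)
import Data.List.Relation.Unary.All as All
open import Data.List.Relation.Unary.All.Properties using (¬Any⇒All¬)
open import Data.List.Membership.Propositional using (_∈_; lose; find)
open import Data.List.Relation.Unary.Unique.Propositional using (Unique)
open import Data.List.Membership.Propositional.Properties
  using ( ∈-filter⁺; ∈-filter⁻; ∈-allFin; ∈-map⁺; ∈-map⁻
        ; ∈-++⁺ˡ; ∈-++⁺ʳ; ∈-++⁻; ∈-concatMap⁺; ∈-concatMap⁻ )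
import Data.List.Extrema ℚₚ.≤-totalOrder as Extrema
open import Data.Product using (_×_; _,_; proj₁; proj₂; ∃-syntax; ∃₂)
open import Data.Sum using (_⊎_; inj₁; inj₂; [_,_]′)
open import Data.Empty using (⊥-elim)
open import Function using (_∘_)
open import Function.Bundles using (_⇔_; mk⇔; Equivalence)
open import Relation.Binary.PropositionalEquality
open import Relation.Binary.Construct.Closure.ReflexiveTransitive using (Star; ε; _◅_)
import Relation.Binary.Construct.On as On
open import Relation.Nullary using (¬_; Dec; yes; no; does; contradiction)
open import Relation.Nullary.Decidable using (_×-dec_; ¬?; dec-true; dec-false)
open import Relation.Unary using (Decidable)
open import Relation.Binary.Definitions using (DecidableEquality)
open import Induction.WellFounded using (Acc; module Subrelation)

private variable
  X : Set
  d d' k : ℕ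
  ℓ : List (Sample d)
  x : Sample d

length-filterᵇ-not+filterᵇ : (p : X → Bool) (xs : List X) →
  length (filterᵇ (not ∘ p) xs) + length (filterᵇ p xs) ≡ length xs
length-filterᵇ-not+filterᵇ p []       = refl
length-filterᵇ-not+filterᵇ p (x ∷ xs) with p x
... | true  = trans (+-suc _ _) (cong suc (length-filterᵇ-not+filterᵇ p xs))
... | false = cong suc (length-filterᵇ-not+filterᵇ p xs)

filterᵇ-not≡[]⇒filterᵇ≡id : (p : X → Bool) (xs : List X) →
  filterᵇ (not ∘ p) xs ≡ [] → filterᵇ p xs ≡ xs
filterᵇ-not≡[]⇒filterᵇ≡id p xs e = filter-complete (T? ∘ p)
  (subst (λ ys → length ys + length (filterᵇ p xs) ≡ length xs) e (length-filterᵇ-not+filterᵇ p xs))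

filterᵇ≡[]⇒filterᵇ-not≡id : (p : X → Bool) (xs : List X) →
  filterᵇ p xs ≡ [] → filterᵇ (not ∘ p) xs ≡ xs
filterᵇ≡[]⇒filterᵇ-not≡id p xs e = filter-complete (T? ∘ not ∘ p) (trans (sym (+-identityʳ _))
  (subst (λ ys → length (filterᵇ (not ∘ p) xs) + length ys ≡ length xs) e
         (length-filterᵇ-not+filterᵇ p xs)))

differingBit : {u v : Vec Bool d} → u ≢ v → ∃[ i ] lookup u i ≢ lookup v i
differingBit {d} {u} {v} u≢v =
  ¬∀⟶∃¬ d _ (λ i → lookup u i Bool.≟ lookup v i) (u≢v ∘ Pointwise-≡⇒≡ ∘ ext)

Splits : Fin d → List (Sample d) → Set
Splits i ℓ = 0 < length (split0 i ℓ) × 0 < length (split1 i ℓ)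

Unsplit : Fin d → List (Sample d) → Set
Unsplit i ℓ = (split0 i ℓ ≡ ℓ × split1 i ℓ ≡ []) ⊎ (split0 i ℓ ≡ [] × split1 i ℓ ≡ ℓ)

Consistent : List (Sample d) → Set
Consistent ℓ = ∀ {u b b'} → (u , b) ∈ ℓ → (u , b') ∈ ℓ → b ≡ b'

length-split : (i : Fin d) (ℓ : List (Sample d)) →
  length (split0 i ℓ) + length (split1 i ℓ) ≡ length ℓ
length-split i = length-filterᵇ-not+filterᵇ (λ x → lookup (proj₁ x) i)

nBad+nGood≡length : (ℓ : List (Sample d)) → nBad ℓ + nGood ℓ ≡ length ℓ
nBad+nGood≡length = length-filterᵇ-not+filterᵇ proj₂

splits⊎unsplit : (i : Fin d) (ℓ : List (Sample d)) → Splits i ℓ ⊎ Unsplit i ℓ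
-- The with-abstraction also replaces split0 i ℓ and split1 i ℓ inside Splits and Unsplit.
splits⊎unsplit i ℓ with split0 i ℓ in e₀ | split1 i ℓ in e₁
... | []    | _     = inj₂ (inj₂ (refl , trans (sym e₁) (filterᵇ-not≡[]⇒filterᵇ≡id _ ℓ e₀)))
... | _ ∷ _ | []    = inj₂ (inj₁ (trans (sym e₀) (filterᵇ≡[]⇒filterᵇ-not≡id _ ℓ e₁) , refl))
... | _ ∷ _ | _ ∷ _ = inj₁ (s≤s z≤n , s≤s z≤n)

consistent-filterᵇ : ∀ p → Consistent ℓ → Consistent (filterᵇ p ℓ)
consistent-filterᵇ p consistent x∈ y∈ =
  consistent (proj₁ (∈-filter⁻ (T? ∘ p) x∈)) (proj₁ (∈-filter⁻ (T? ∘ p) y∈))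

0<length-split0 : ∀ {i} → x ∈ ℓ → lookup (proj₁ x) i ≡ false → 0 < length (split0 i ℓ)
0<length-split0 x∈ e = filter-some (T? ∘ _) (lose x∈ (Equivalence.from T-not-≡ e))

0<length-split1 : ∀ {i} → x ∈ ℓ → lookup (proj₁ x) i ≡ true → 0 < length (split1 i ℓ)
0<length-split1 x∈ e = filter-some (T? ∘ _) (lose x∈ (Equivalence.from T-≡ e))

consistent-mixed⇒splits : Consistent ℓ → Mixed ℓ → ∃[ i ] Splits i ℓ
consistent-mixed⇒splits consistent (good , bad) with find good | find bad
... | (u , _) , u∈ , refl | (v , _) , v∈ , refl
  with differingBit {u = u} {v} (λ { refl → contradiction (consistent u∈ v∈) λ () })
... | i , bits≢ with lookup u i in eu | lookup v i in ev
... | false | true  = i , 0<length-split0 u∈ eu , 0<length-split1 v∈ ev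
... | true  | false = i , 0<length-split0 v∈ ev , 0<length-split1 u∈ eu
... | false | false = contradiction refl bits≢
... | true  | true  = contradiction refl bits≢

0<nGood : Any (λ x → proj₂ x ≡ true) ℓ → 0 < nGood ℓ
0<nGood = filter-some (T? ∘ proj₂) ∘ Any.map (Equivalence.from T-≡)

0<nBad : Any (λ x → proj₂ x ≡ false) ℓ → 0 < nBad ℓ
0<nBad = filter-some (T? ∘ not ∘ proj₂) ∘ Any.map (Equivalence.from T-not-≡)

nGood≡0 : ¬ Any (λ x → proj₂ x ≡ true) ℓ → nGood ℓ ≡ 0
nGood≡0 {ℓ = ℓ} none = cong length (filter-none (T? ∘ proj₂)
  (¬Any⇒All¬ ℓ (none ∘ Any.map (Equivalence.to T-≡))))

nBad≡0 : ¬ Any (λ x → proj₂ x ≡ false) ℓ → nBad ℓ ≡ 0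
nBad≡0 {ℓ = ℓ} none = cong length (filter-none (T? ∘ not ∘ proj₂)
  (¬Any⇒All¬ ℓ (none ∘ Any.map (Equivalence.to T-not-≡))))

maxclass-correct : ¬ Mixed ℓ → ∀ {x} → x ∈ ℓ → proj₂ x ≡ maxclass ℓ
maxclass-correct {ℓ = ℓ} unmixed {x} x∈ with proj₂ x in e
... | true  = sym (cong (_≤ᵇ nGood ℓ) (nBad≡0 (λ bad → unmixed (lose x∈ e , bad))))
... | false = sym (trans (cong (nBad ℓ ≤ᵇ_) (nGood≡0 (λ good → unmixed (good , lose x∈ e))))
                         (positive≰ᵇ0 (0<nBad (lose x∈ e))))
  where
  positive≰ᵇ0 : ∀ {n} → 0 < n → (n ≤ᵇ 0) ≡ false
  positive≰ᵇ0 (s≤s z≤n) = refl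

frac+frac≃1 : ∀ {p q n} → p + q ≡ n → 0 < n → frac p n ℚ.+ frac q n ℚ.≃ 1ℚᵘ
frac+frac≃1 {p} {q} {suc m} p+q≡n _ = *≡* (begin
  (+ p ℤ.* + suc m ℤ.+ + q ℤ.* + suc m) ℤ.* + 1  ≡⟨ ℤ.*-identityʳ _ ⟩
  + p ℤ.* + suc m ℤ.+ + q ℤ.* + suc m            ≡⟨ ℤ.*-distribʳ-+ (+ suc m) (+ p) (+ q) ⟨
  + (p + q) ℤ.* + suc m                          ≡⟨ cong (λ n → + n ℤ.* + suc m) p+q≡n ⟩
  + suc m ℤ.* + suc m                            ≡⟨ ℤ.pos-* (suc m) (suc m) ⟨
  + (suc m * suc m)                              ≡⟨ ℤ.*-identityˡ _ ⟨
  + 1 ℤ.* + (suc m * suc m)                      ∎)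
  where open ≡-Reasoning

frac<1 : ∀ {p n} → p < n → frac p n ℚ.< 1ℚᵘ
frac<1 {p} {suc m} p<n =
  *<* (subst₂ ℤ._<_ (sym (ℤ.*-identityʳ (+ p))) (sym (ℤ.*-identityˡ (+ suc m))) (ℤ.+<+ p<n))

x+y≃p+p⇒p≤x⊔y : ∀ x y {p} → x ℚ.+ y ℚ.≃ p ℚ.+ p → p ℚ.≤ x ℚ.⊔ y
x+y≃p+p⇒p≤x⊔y x y {p} x+y≃p+p with p ℚₚ.≤? x | p ℚₚ.≤? y
... | yes p≤x | _     = ℚₚ.p≤q⇒p≤q⊔r y p≤x
... | no _    | yes p≤y = ℚₚ.p≤q⇒p≤r⊔q x p≤y
... | no p≰x  | no p≰y  =
  contradiction (ℚₚ.+-mono-< (ℚₚ.≰⇒> p≰x) (ℚₚ.≰⇒> p≰y)) (ℚₚ.<-irrefl x+y≃p+p)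

badShare goodShare : List (Sample d) → ℚᵘ
badShare ℓ  = frac (nBad ℓ) (length ℓ)
goodShare ℓ = frac (nGood ℓ) (length ℓ)

-- score ℓ i is pairScore (split0 i ℓ) (split1 i ℓ) by definition.
pairScore : List (Sample d) → List (Sample d) → ℚᵘ
pairScore ℓ₀ ℓ₁ = (badShare ℓ₀ ℚ.+ goodShare ℓ₁) ℚ.⊔ (goodShare ℓ₀ ℚ.+ badShare ℓ₁)

badShare+goodShare≃1 : (ℓ : List (Sample d)) → 0 < length ℓ → badShare ℓ ℚ.+ goodShare ℓ ℚ.≃ 1ℚᵘ
badShare+goodShare≃1 ℓ = frac+frac≃1 (nBad+nGood≡length ℓ)

badShare<1 : Mixed ℓ → badShare ℓ ℚ.< 1ℚᵘ
badShare<1 {ℓ = ℓ} (good , _) =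
  frac<1 (subst (nBad ℓ <_) (nBad+nGood≡length ℓ) (m<m+n (nBad ℓ) (0<nGood good)))

goodShare<1 : Mixed ℓ → goodShare ℓ ℚ.< 1ℚᵘ
goodShare<1 {ℓ = ℓ} (_ , bad) =
  frac<1 (subst (nGood ℓ <_) (nBad+nGood≡length ℓ) (m<n+m (nGood ℓ) (0<nBad bad)))

1≤pairScore : (ℓ₀ ℓ₁ : List (Sample d)) → 0 < length ℓ₀ → 0 < length ℓ₁ → 1ℚᵘ ℚ.≤ pairScore ℓ₀ ℓ₁
1≤pairScore ℓ₀ ℓ₁ 0<∣ℓ₀∣ 0<∣ℓ₁∣ =
  x+y≃p+p⇒p≤x⊔y (badShare ℓ₀ ℚ.+ goodShare ℓ₁) (goodShare ℓ₀ ℚ.+ badShare ℓ₁) (begin-equality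
  (badShare ℓ₀ ℚ.+ goodShare ℓ₁) ℚ.+ (goodShare ℓ₀ ℚ.+ badShare ℓ₁)
    ≃⟨ interchange (badShare ℓ₀) (goodShare ℓ₁) (goodShare ℓ₀) (badShare ℓ₁) ⟩
  (badShare ℓ₀ ℚ.+ goodShare ℓ₀) ℚ.+ (goodShare ℓ₁ ℚ.+ badShare ℓ₁)
    ≃⟨ ℚₚ.+-cong (badShare+goodShare≃1 ℓ₀ 0<∣ℓ₀∣)
                 (ℚₚ.≃-trans (ℚₚ.+-comm (goodShare ℓ₁) (badShare ℓ₁))
                             (badShare+goodShare≃1 ℓ₁ 0<∣ℓ₁∣)) ⟩
  1ℚᵘ ℚ.+ 1ℚᵘ ∎)
  where open ℚₚ.≤-Reasoning

pairScore[ℓ,[]]<1 : Mixed ℓ → pairScore ℓ [] ℚ.< 1ℚᵘ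
pairScore[ℓ,[]]<1 mixed = ℚₚ.⊔-mono-<
  (ℚₚ.<-respˡ-≃ (ℚₚ.≃-sym (ℚₚ.+-identityʳ _)) (badShare<1 mixed))
  (ℚₚ.<-respˡ-≃ (ℚₚ.≃-sym (ℚₚ.+-identityʳ _)) (goodShare<1 mixed))

pairScore[[],ℓ]<1 : Mixed ℓ → pairScore [] ℓ ℚ.< 1ℚᵘ
pairScore[[],ℓ]<1 mixed = ℚₚ.⊔-mono-<
  (ℚₚ.<-respˡ-≃ (ℚₚ.≃-sym (ℚₚ.+-identityˡ _)) (goodShare<1 mixed))
  (ℚₚ.<-respˡ-≃ (ℚₚ.≃-sym (ℚₚ.+-identityˡ _)) (badShare<1 mixed))

unsplit⇒score<1 : ∀ {i} → Mixed ℓ → Unsplit i ℓ → score ℓ i ℚ.< 1ℚᵘ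
unsplit⇒score<1 mixed (inj₁ (e₀ , e₁)) =
  subst₂ (λ ℓ₀ ℓ₁ → pairScore ℓ₀ ℓ₁ ℚ.< 1ℚᵘ) (sym e₀) (sym e₁) (pairScore[ℓ,[]]<1 mixed)
unsplit⇒score<1 mixed (inj₂ (e₀ , e₁)) =
  subst₂ (λ ℓ₀ ℓ₁ → pairScore ℓ₀ ℓ₁ ℚ.< 1ℚᵘ) (sym e₀) (sym e₁) (pairScore[[],ℓ]<1 mixed)

minFin-glb : ∀ {m c} (f : Fin (suc m) → ℚᵘ) → (∀ i → c ℚ.≤ f i) → c ℚ.≤ minFin f
minFin-glb {zero}  f c≤f = c≤f Fin.zero
minFin-glb {suc m} f c≤f = ℚₚ.⊓-glb (c≤f Fin.zero) (minFin-glb (f ∘ Fin.suc) (c≤f ∘ Fin.suc))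

minFin-1 : ∀ {m} (f : Fin (suc m) → ℚᵘ) → (∀ i → f i ≡ 1ℚᵘ) → minFin f ≡ 1ℚᵘ
minFin-1 {zero}  f f≡1 = f≡1 Fin.zero
minFin-1 {suc m} f f≡1 = cong₂ ℚ._⊓_ (f≡1 Fin.zero) (minFin-1 (f ∘ Fin.suc) (f≡1 ∘ Fin.suc))

expWE-[] : ∀ j (i : Fin (suc d')) → expWE j [] i ≡ 1ℚᵘ
expWE-[] zero    i = refl
expWE-[] {d'} (suc j) i =
  minFin-1 {d'} _ λ i₀ → minFin-1 {d'} _ λ i₁ → cong₂ ℚ._*_ (expWE-[] j i₀) (expWE-[] j i₁)

noGainBelow⇒expWE0≤expWE : ∀ j →
  (∀ j' → 1 ≤ j' → j' < suc j → ∀ i → ¬ PosGain j' ℓ i) →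
  ∀ i → expWE0 ℓ ℚ.≤ expWE j ℓ i
noGainBelow⇒expWE0≤expWE zero    noGain i = ℚₚ.≤-refl
noGainBelow⇒expWE0≤expWE (suc j) noGain i = ℚₚ.≮⇒≥ (noGain (suc j) (s≤s z≤n) ≤-refl i)

unsplit⇒expWE0≤expWE : ∀ {bit} j → Unsplit bit ℓ →
  (∀ i → expWE0 ℓ ℚ.≤ expWE j ℓ i) → expWE0 ℓ ℚ.≤ expWE (suc j) ℓ bit
unsplit⇒expWE0≤expWE {ℓ = ℓ} {bit = bit} j unsplit bound =
  minFin-glb _ λ i₀ → minFin-glb _ λ i₁ → expWE0≤product unsplit i₀ i₁
  where
  expWE0≤product : Unsplit bit ℓ → ∀ i₀ i₁ →
    expWE0 ℓ ℚ.≤ expWE j (split0 bit ℓ) i₀ ℚ.* expWE j (split1 bit ℓ) i₁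
  expWE0≤product (inj₁ (e₀ , e₁)) i₀ i₁ rewrite e₀ | e₁ | expWE-[] j i₁ =
    ℚₚ.≤-respʳ-≃ (ℚₚ.≃-sym (ℚₚ.*-identityʳ _)) (bound i₀)
  expWE0≤product (inj₂ (e₀ , e₁)) i₀ i₁ rewrite e₀ | e₁ | expWE-[] j i₀ =
    ℚₚ.≤-respʳ-≃ (ℚₚ.≃-sym (ℚₚ.*-identityˡ _)) (bound i₁)

validBit-splits : ∀ {bit} →
  Consistent ℓ → Mixed ℓ → ValidBit k ℓ bit → Splits bit ℓ
validBit-splits {ℓ = ℓ} {bit = bit} consistent mixed valid with splits⊎unsplit bit ℓ
... | inj₁ splits  = splits
... | inj₂ unsplit = ⊥-elim (invalid valid)
  where
  invalid : ¬ ValidBit _ ℓ bit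
  invalid (inj₁ (zero , () , _))
  invalid (inj₁ (suc j , _ , _ , (i , gain) , noGainBelow , best)) =
    ℚₚ.<-irrefl ℚₚ.≃-refl (ℚₚ.≤-<-trans
      (unsplit⇒expWE0≤expWE j unsplit (noGainBelow⇒expWE0≤expWE j noGainBelow))
      (ℚₚ.≤-<-trans (best i) gain))
  invalid (inj₂ (_ , best)) with consistent-mixed⇒splits consistent mixed
  ... | i , 0<∣ℓ₀∣ , 0<∣ℓ₁∣ =
    ℚₚ.<-irrefl ℚₚ.≃-refl (ℚₚ.≤-<-trans
      (ℚₚ.≤-trans (1≤pairScore (split0 i ℓ) (split1 i ℓ) 0<∣ℓ₀∣ 0<∣ℓ₁∣) (best i))
      (unsplit⇒score<1 mixed unsplit))

argmin-Fin : ∀ {m} (f : Fin (suc m) → ℚᵘ) → ∃[ i ] ∀ i' → f i ℚ.≤ f i'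
argmin-Fin {m} f = Extrema.argmin f Fin.zero (allFin _) ,
  λ i' → All.lookup (Extrema.f[argmin]≤f[xs] {f = f} Fin.zero (allFin (suc m))) (∈-allFin i')

argmax-Fin : ∀ {m} (f : Fin (suc m) → ℚᵘ) → ∃[ i ] ∀ i' → f i' ℚ.≤ f i
argmax-Fin {m} f = Extrema.argmax f Fin.zero (allFin _) ,
  λ i' → All.lookup (Extrema.f[xs]≤f[argmax] {f = f} Fin.zero (allFin (suc m))) (∈-allFin i')

least-in-range : {P : ℕ → Set} → Decidable P → ∀ k →
  (∀ j → 1 ≤ j → j ≤ k → ¬ P j) ⊎
  ∃[ j ] (1 ≤ j × j ≤ k × P j × (∀ j' → 1 ≤ j' → j' < j → ¬ P j'))
least-in-range P? zero = inj₁ λ { _ (s≤s _) () }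
least-in-range P? (suc k) with least-in-range P? k
... | inj₂ (j , 1≤j , j≤k , p , below) = inj₂ (j , 1≤j , m≤n⇒m≤1+n j≤k , p , below)
... | inj₁ none with P? (suc k)
...   | yes p  = inj₂ (suc k , s≤s z≤n , ≤-refl , p , λ j 1≤j j<1+k → none j 1≤j (≤-pred j<1+k))
...   | no ¬p = inj₁ λ j 1≤j j≤1+k →
  [ none j 1≤j ∘ ≤-pred , (λ { refl → ¬p }) ]′ (m≤n⇒m<n∨m≡n j≤1+k)

validBit-exists : ∀ k (ℓ : List (Sample (suc d'))) → ∃[ bit ] ValidBit k ℓ bit
validBit-exists k ℓ with least-in-range (λ j → any? λ i → expWE j ℓ i ℚₚ.<? expWE0 ℓ) k
... | inj₁ noGain =
  let bit , best = argmax-Fin (score ℓ)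
  in bit , inj₂ ((λ j 1≤j j≤k i gain → noGain j 1≤j j≤k (i , gain)) , best)
... | inj₂ (j , 1≤j , j≤k , gain , noGainBelow) =
  let bit , best = argmin-Fin (expWE j ℓ)
  in bit , inj₁ (j , 1≤j , j≤k , gain ,
                 (λ j' 1≤j' j'<j i gain' → noGainBelow j' 1≤j' j'<j (i , gain')) , best)

mixed? : (ℓ : List (Sample d)) → Dec (Mixed ℓ)
mixed? ℓ = Any.any? (λ x → proj₂ x Bool.≟ true) ℓ ×-dec Any.any? (λ x → proj₂ x Bool.≟ false) ℓ

noMixedLeaf? : (ℓ : List (Sample (suc d'))) (t : Tree (suc d')) → Dec (NoMixedLeaf ℓ t)
noMixedLeaf? ℓ (leaf c)       = ¬? (mixed? ℓ)
noMixedLeaf? ℓ (node i t₀ t₁) = noMixedLeaf? (split0 i ℓ) t₀ ×-dec noMixedLeaf? (split1 i ℓ) t₁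

progress : ∀ k (ℓ : List (Sample (suc d'))) t → ¬ NoMixedLeaf ℓ t → ∃[ t' ] Step k ℓ t t'
progress k ℓ (leaf c) ¬done with mixed? ℓ
... | yes mixed  = _ , here mixed (proj₂ (validBit-exists k ℓ))
... | no unmixed = contradiction unmixed ¬done
progress k ℓ (node i t₀ t₁) ¬done with noMixedLeaf? (split0 i ℓ) t₀
... | no ¬done₀ = _ , left (proj₂ (progress k (split0 i ℓ) t₀ ¬done₀))
... | yes done₀ = _ , right (proj₂ (progress k (split1 i ℓ) t₁ (λ done₁ → ¬done (done₀ , done₁))))

potential : List (Sample d) → Tree d → ℕ
potential ℓ (leaf c)       = pred (length ℓ)
potential ℓ (node i t₀ t₁) = potential (split0 i ℓ) t₀ + potential (split1 i ℓ) t₁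

pred+pred<pred : ∀ {m n l} → 0 < m → 0 < n → m + n ≡ l → pred m + pred n < pred l
pred+pred<pred {suc m} {suc n} _ _ refl = ≤-reflexive (sym (+-suc m n))

potential-decreases : ∀ {t t'} →
  Consistent ℓ → Step k ℓ t t' → potential ℓ t' < potential ℓ t
potential-decreases {ℓ = ℓ} consistent (here {bit = bit} mixed valid) =
  let 0<∣ℓ₀∣ , 0<∣ℓ₁∣ = validBit-splits consistent mixed valid
  in pred+pred<pred 0<∣ℓ₀∣ 0<∣ℓ₁∣ (length-split bit ℓ)
potential-decreases {ℓ = ℓ} consistent (left {i = i} {t₁ = t₁} step) =
  +-monoˡ-< (potential (split1 i ℓ) t₁) (potential-decreases (consistent-filterᵇ _ consistent) step)
potential-decreases {ℓ = ℓ} consistent (right {i = i} {t₀ = t₀} step) =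
  +-monoʳ-< (potential (split0 i ℓ) t₀) (potential-decreases (consistent-filterᵇ _ consistent) step)

Step-accessible : ∀ {t} → Consistent ℓ → Acc (λ t' t → Step k ℓ t t') t
Step-accessible {ℓ = ℓ} {t = t} consistent =
  Subrelation.accessible (potential-decreases consistent)
    (On.accessible (potential ℓ) (<-wellFounded (potential ℓ t)))

LeafLabelsCorrect : List (Sample d) → Tree d → Set
LeafLabelsCorrect ℓ (leaf c)       = ¬ Mixed ℓ → ∀ {x} → x ∈ ℓ → proj₂ x ≡ c
LeafLabelsCorrect ℓ (node i t₀ t₁) =
  LeafLabelsCorrect (split0 i ℓ) t₀ × LeafLabelsCorrect (split1 i ℓ) t₁

Step-preserves-labels : ∀ {t t'} →
  Step k ℓ t t' → LeafLabelsCorrect ℓ t → LeafLabelsCorrect ℓ t'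
Step-preserves-labels (here _ _)  _           = maxclass-correct , maxclass-correct
Step-preserves-labels (left step)  (ok₀ , ok₁) = Step-preserves-labels step ok₀ , ok₁
Step-preserves-labels (right step) (ok₀ , ok₁) = ok₀ , Step-preserves-labels step ok₁

Star-preserves-labels : ∀ {t t'} →
  Star (Step k ℓ) t t' → LeafLabelsCorrect ℓ t → LeafLabelsCorrect ℓ t'
Star-preserves-labels ε             correct = correct
Star-preserves-labels (step ◅ steps) correct =
  Star-preserves-labels steps (Step-preserves-labels step correct)

eval-correct : ∀ t → NoMixedLeaf ℓ t → LeafLabelsCorrect ℓ t →
  x ∈ ℓ → eval t (proj₁ x) ≡ proj₂ x
eval-correct (leaf c) unmixed correct x∈ = sym (correct unmixed x∈)
eval-correct {x = x} (node i t₀ t₁) (done₀ , done₁) (correct₀ , correct₁) x∈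
  with lookup (proj₁ x) i in e
... | false = eval-correct t₀ done₀ correct₀ (∈-filter⁺ (T? ∘ _) x∈ (Equivalence.from T-not-≡ e))
... | true  = eval-correct t₁ done₁ correct₁ (∈-filter⁺ (T? ∘ _) x∈ (Equivalence.from T-≡ e))

module TrainingSet {n a : ℕ} (SR : List (Vec Bool n)) (A : List (Vec Bool a))
                   (σ : Vec Bool n → Vec Bool a) where

  private
    _≟ᵥ_ : DecidableEquality (Vec Bool a)
    _≟ᵥ_ = ≡-dec Bool._≟_

    wrong? : ∀ s → Decidable (_≢ σ s)
    wrong? s b = ¬? (b ≟ᵥ σ s)

    badSamplesAt : Vec Bool n → List (Sample (n + a))
    badSamplesAt s = map (λ b → (s ++ b , false)) (filter (wrong? s) A)

  good∈Train : ∀ {s} → s ∈ SR → (s ++ σ s , true) ∈ Train SR A σ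
  good∈Train s∈ = ∈-++⁺ˡ (∈-map⁺ (λ s → (s ++ σ s , true)) s∈)

  bad∈Train : ∀ {s b} → s ∈ SR → b ∈ A → b ≢ σ s → (s ++ b , false) ∈ Train SR A σ
  bad∈Train {s} s∈ b∈ b≢σs = ∈-++⁺ʳ (GoodSamples SR A σ) (∈-concatMap⁺ badSamplesAt
    (Any.map (λ { refl → ∈-map⁺ (λ b → (s ++ b , false)) (∈-filter⁺ (wrong? s) b∈ b≢σs) }) s∈))

  ∈-Train⁻ : ∀ {x} → x ∈ Train SR A σ → ∃₂ λ s b → s ∈ SR × x ≡ (s ++ b , does (b ≟ᵥ σ s))
  ∈-Train⁻ x∈ with ∈-++⁻ (GoodSamples SR A σ) x∈
  ... | inj₁ x∈good with ∈-map⁻ (λ s → (s ++ σ s , true)) x∈good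
  ...   | s , s∈ , refl = s , σ s , s∈ , cong (s ++ σ s ,_) (sym (dec-true (σ s ≟ᵥ σ s) refl))
  ∈-Train⁻ x∈ | inj₂ x∈bad with find (∈-concatMap⁻ badSamplesAt {xs = SR} x∈bad)
  ...   | s , s∈ , x∈s with ∈-map⁻ (λ b → (s ++ b , false)) x∈s
  ...     | b , b∈ , refl = s , b , s∈ ,
    cong (s ++ b ,_) (sym (dec-false (b ≟ᵥ σ s) (proj₂ (∈-filter⁻ (wrong? s) {xs = A} b∈))))

  Train-consistent : Consistent (Train SR A σ)
  Train-consistent u∈ u∈' with ∈-Train⁻ u∈ | ∈-Train⁻ u∈'
  ... | s , b , _ , e | s' , b' , _ , e'
    with ++-injective s s' (trans (sym (cong proj₁ e)) (cong proj₁ e'))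
  ... | refl , refl = trans (cong proj₂ e) (sym (cong proj₂ e'))

  Train-labelsCorrect : LeafLabelsCorrect (Train SR A σ) (leaf true)
  Train-labelsCorrect unmixed {x} x∈ with proj₂ x in e | ∈-Train⁻ x∈
  ... | true  | _              = refl
  ... | false | s , _ , s∈ , _ = contradiction (lose (good∈Train s∈) refl , lose x∈ e) unmixed

  represents : (t : Tree (n + a)) → (∀ {x} → x ∈ Train SR A σ → eval t (proj₁ x) ≡ proj₂ x) →
    ∀ {s b} → s ∈ SR → b ∈ A → Lang t (s ++ b) ⇔ σ s ≡ b
  represents t correct {s} {b} s∈ b∈ with b ≟ᵥ σ s
  ... | yes refl = mk⇔ (λ _ → refl) (λ _ → correct (good∈Train s∈))
  ... | no b≢σs  = mk⇔
    (λ accepted → contradiction (trans (sym accepted) (correct (bad∈Train s∈ b∈ b≢σs))) λ ())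
    (λ σs≡b → contradiction (sym σs≡b) b≢σs)

mainTheorem1 : ∀ (n' a' : ℕ)
    (SR : List (Vec Bool (suc n'))) (A : List (Vec Bool (suc a')))
    (σ : Vec Bool (suc n') → Vec Bool (suc a')) →
    Unique SR → Unique A → (∀ {s} → s ∈ SR → σ s ∈ A) →
    ∀ (k : ℕ) → 1 ≤ k →
    -- every run of k-look-ahead ID3 from the initial tree is finite
    Acc (λ t' t → Step k (Train SR A σ) t t') (leaf true)
    × (∀ t → Star (Step k (Train SR A σ)) (leaf true) t →
         -- a reachable tree with no mixed leaf (the output) represents σ
         (NoMixedLeaf (Train SR A σ) t →
            ∀ {s a''} → s ∈ SR → a'' ∈ A → (Lang t (s ++ a'') ⇔ σ s ≡ a''))
         -- the algorithm never gets stuck while a mixed leaf remains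
         × (¬ NoMixedLeaf (Train SR A σ) t → ∃[ t' ] Step k (Train SR A σ) t t'))
mainTheorem1 n' a' SR A σ _ _ _ k _ =
  Step-accessible Train-consistent ,
  λ t run →
    (λ done → represents t (eval-correct t done (Star-preserves-labels run Train-labelsCorrect))) ,
    progress k (Train SR A σ) t
  where open TrainingSet SR A σ
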